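{- Let $D$ be a finite simple digraph (no loops, no parallel arcs; opposite arcs allowed) whose arcs are each colored either blue or red; write $u \overset{b}{\to} v$ (resp. $u \overset{r}{\to} v$) if $(u,v)$ is a blue (resp. red) arc. Suppose that: (i) $D$ has no monochromatic directed cycle; (ii) whenever $(v_1,v_2),(v_2,v_3),(v_3,v_4)$ is a directed path of $D$, either open ($v_1,v_2,v_3,v_4$ distinct) or closed ($v_4=v_1$, with $v_1,v_2,v_3$ distinct), such that $v_1 \overset{r}{\to} v_2$ and $v_3 \overset{b}{\to} v_4$, the subdigraph induced by its vertices contains at least one further arc (other than these three) whose head is not $v_2$. Then $D$ has a kernel.
   Context: A kernel of $D$ is a set $S\subseteq V(D)$ with no arc between two of its vertices such that every vertex outside $S$ has an outneighbor in $S$. -}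

module Defs where

open import Data.Nat using (ℕ)
open import Data.Fin using (Fin)
open import Data.Fin.Subset using (Subset; _∈_; _∉_)
open import Data.Maybe using (Maybe; just; nothing)
open import Data.List using (List; []; _∷_)
open import Data.List.Relation.Unary.Unique.Propositional using (Unique)
open import Data.Product using (Σ; ∃; _×_; _,_)
open import Data.Sum using (_⊎_)
open import Relation.Binary.PropositionalEquality using (_≡_; _≢_)
open import Relation.Nullary using (¬_)

data Colour : Set where
  blue red : Colour

-- A function value per ordered pair rules out parallel arcs (opposite arcs
-- (u,v),(v,u) are allowed); loopless is an explicit field.
record ColouredDigraph (n : ℕ) : Set where
  field
    col      : Fin n → Fin n → Maybe Colour
    loopless : ∀ v → col v v ≡ nothing

open ColouredDigraph public

module _ {n : ℕ} (D : ColouredDigraph n) where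

  Arc : Fin n → Fin n → Set
  Arc u v = ∃ λ c → col D u v ≡ just c

  ArcOf : Colour → Fin n → Fin n → Set
  ArcOf c u v = col D u v ≡ just c

  PathC : Colour → Fin n → Fin n → List (Fin n) → Set
  PathC c x0 u []       = ArcOf c u x0
  PathC c x0 u (v ∷ vs) = ArcOf c u v × PathC c x0 v vs

  -- a directed cycle v0 → v1 → … → vk → v0 on distinct vertices, all arcs
  -- of colour c (length ≥ 2 is automatic since D has no loops)
  MonoCycle : Colour → Set
  MonoCycle c = Σ (Fin n) λ v0 → Σ (List (Fin n)) λ vs →
                  Unique (v0 ∷ vs) × PathC c v0 v0 vs

  HasMonoCycle : Set
  HasMonoCycle = ∃ MonoCycle

  IsKernel : Subset n → Set
  IsKernel S = (∀ u v → u ∈ S → v ∈ S → ¬ Arc u v)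
             × (∀ v → v ∉ S → ∃ λ u → u ∈ S × Arc v u)

  HasKernel : Set
  HasKernel = ∃ IsKernel

  In4 : Fin n → Fin n → Fin n → Fin n → Fin n → Set
  In4 v1 v2 v3 v4 x = x ≡ v1 ⊎ x ≡ v2 ⊎ x ≡ v3 ⊎ x ≡ v4

  Open4 : Fin n → Fin n → Fin n → Fin n → Set
  Open4 v1 v2 v3 v4 = v1 ≢ v2 × v1 ≢ v3 × v1 ≢ v4 × v2 ≢ v3 × v2 ≢ v4 × v3 ≢ v4

  Closed4 : Fin n → Fin n → Fin n → Fin n → Set
  Closed4 v1 v2 v3 v4 = v4 ≡ v1 × v1 ≢ v2 × v1 ≢ v3 × v2 ≢ v3

  Condition-ii : Set
  Condition-ii =
    ∀ v1 v2 v3 v4 →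
      ArcOf red v1 v2 → Arc v2 v3 → ArcOf blue v3 v4 →
      (Open4 v1 v2 v3 v4 ⊎ Closed4 v1 v2 v3 v4) →
      ∃ λ x → ∃ λ y →
        In4 v1 v2 v3 v4 x × In4 v1 v2 v3 v4 y × Arc x y
        × ¬ ((x ≡ v1 × y ≡ v2) ⊎ (x ≡ v2 × y ≡ v3) ⊎ (x ≡ v3 × y ≡ v4))
        × y ≢ v2

-- Grow an independent set K, keeping the invariant that no red arc leads from K to a
-- free vertex (one neither in K nor absorbed by K). While some vertex is free, follow
-- red arcs among free vertices; by red acyclicity this ends at a free vertex x with no
-- red arc to a free vertex. Add x to K and drop the in-neighbours of x from K. Each
-- dropped vertex k₀ sends a blue arc to x, since x was free. Condition (ii) keeps the
-- invariant: a red arc k → u onto a newly freed u gives the path k →r u → k₀ →b x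
-- through a dropped k₀, and any further arc of it would join two vertices of an
-- independent set or make u or x absorbed. Dropped vertices have larger blue rank than
-- x, so with weights (n+1)^(−blue rank) the weight outside K strictly decreases; hence
-- the process stops, and it stops only at a kernel.
module Submission where

open import Defs
open import Data.Bool using (Bool; true; false; if_then_else_)
open import Data.Bool.Properties using () renaming (_≟_ to _≟ᵇ_)
open import Data.Fin using (Fin; _≟_; punchIn)
open import Data.Fin.Properties using (any?)
open import Data.Fin.Subset using (Subset; ⊤; _-_; _⊂_) renaming (_∈_ to _∈ₛ_; _∉_ to _∉ₛ_)
open import Data.Fin.Subset.Properties using (∈⊤; x∈p⇒p-x⊂p; x∈p∧x≢y⇒x∈p-y)
open import Data.Fin.Subset.Induction using (⊂-wellFounded)
open import Data.List using (List; []; _∷_; _++_; [_])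
open import Data.List.Membership.Propositional using (_∈_)
open import Data.List.Membership.Propositional.Properties using (∈-++⁺ˡ; ∈-++⁺ʳ)
open import Data.List.Relation.Unary.All using ([])
open import Data.List.Relation.Unary.AllPairs using ([]; _∷_)
open import Data.List.Relation.Unary.Any using (here; there)
open import Data.List.Relation.Unary.Unique.Propositional using (Unique)
open import Data.List.Relation.Unary.Unique.Propositional.Properties using (++⁺)
open import Data.Maybe using (just; nothing)
open import Data.Maybe.Properties using (≡-dec)
open import Data.Nat using (ℕ; zero; suc; _+_; _*_; _∸_; _^_; _≤_; _<_; z≤n; s≤s; NonZero; >-nonZero)
open import Data.Nat.Induction using (<-wellFounded)
open import Data.Nat.Properties
  using (+-*-semiring; ≤-refl; ≤-reflexive; ≤-trans; n≤1+n; m≤m+n; +-mono-≤; +-monoʳ-<; +-cancelʳ-<;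
         *-zeroʳ; *-monoʳ-≤; *-monoˡ-<; *-cancelˡ-<; m^n>0; ^-monoʳ-≤; ∸-monoʳ-<; module ≤-Reasoning)
open import Data.Nat.Tactic.RingSolver using (solve-∀)
open import Data.Product using (∃; _×_; _,_; proj₁; proj₂)
open import Data.Sum using (_⊎_; inj₁; inj₂; fromInj₂)
open import Data.Vec using (tabulate)
open import Data.Vec.Functional using (removeAt; head; tail)
open import Data.Vec.Properties using (lookup∘tabulate; []=⇒lookup; lookup⇒[]=)
open import Function using (flip; _∘_)
open import Induction.WellFounded using (Acc; acc; WellFounded; WfRec)
open import Relation.Binary.Definitions using (Decidable; DecidableEquality)
open import Relation.Binary.PropositionalEquality using (_≡_; _≢_; refl; sym; trans; cong; subst₂)
open import Relation.Nullary using (¬_; Dec; yes; no; contradiction)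
open import Relation.Nullary.Decidable using (_×-dec_; ¬?; decidable-stable)

open import Algebra.Properties.Semiring.Sum +-*-semiring using (sum; sum-remove; sum-cong-≗; *-distribˡ-sum)

≤-sum : ∀ {m} (f : Fin m → ℕ) i → f i ≤ sum f
≤-sum {suc m} f i = ≤-trans (m≤m+n (f i) _) (≤-reflexive (sym (sum-remove {i = i} f)))

sum-mono-+ : ∀ {m} (f g : Fin m → ℕ) a → (∀ i → f i ≤ g i + a) → sum f ≤ sum g + m * a
sum-mono-+ {zero}  f g a f≤g+a = z≤n
sum-mono-+ {suc m} f g a f≤g+a = begin
  head f + sum (tail f)               ≤⟨ +-mono-≤ (f≤g+a _) (sum-mono-+ (tail f) (tail g) a (λ i → f≤g+a _)) ⟩
  head g + a + (sum (tail g) + m * a) ≡⟨ rearrange (head g) a (sum (tail g)) (m * a) ⟩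
  head g + sum (tail g) + (a + m * a) ∎
  where
  open ≤-Reasoning
  rearrange : ∀ w x y z → w + x + (y + z) ≡ w + y + (x + z)
  rearrange = solve-∀

sum-<-exchange : ∀ {m} (f g : Fin m → ℕ) (x : Fin m) {a} → 0 < a → g x + a ≤ f x →
                 (∀ i → suc m * g i ≤ suc m * f i + a) → sum g < sum f
sum-<-exchange {suc k} f g x {a} 0<a gx+a≤fx Bg≤Bf+a =
  *-cancelˡ-< B (sum g) (sum f) (+-cancelʳ-< (B * a) (B * sum g) (B * sum f) (begin-strict
    B * sum g + B * a                          ≡⟨ cong (λ s → B * s + B * a) (sum-remove {i = x} g) ⟩
    B * (g x + sum (removeAt g x)) + B * a     ≡⟨ regroup B (g x) a (sum (removeAt g x)) ⟩
    B * (g x + a) + B * sum (removeAt g x)     ≤⟨ +-mono-≤ (*-monoʳ-≤ B gx+a≤fx) rest ⟩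
    B * f x + (B * sum (removeAt f x) + k * a) ≡⟨ regroup′ B (f x) (sum (removeAt f x)) (k * a) ⟩
    B * (f x + sum (removeAt f x)) + k * a     ≡⟨ cong (λ s → B * s + k * a) (sum-remove {i = x} f) ⟨
    B * sum f + k * a                          <⟨ +-monoʳ-< (B * sum f) ka<Ba ⟩
    B * sum f + B * a                          ∎))
  where
  open ≤-Reasoning
  B : ℕ
  B = suc (suc k)
  rest : B * sum (removeAt g x) ≤ B * sum (removeAt f x) + k * a
  rest = subst₂ (λ l r → l ≤ r + k * a)
           (sym (*-distribˡ-sum B (removeAt g x))) (sym (*-distribˡ-sum B (removeAt f x)))
           (sum-mono-+ (λ i → B * g (punchIn x i)) (λ i → B * f (punchIn x i)) a
                       (λ i → Bg≤Bf+a (punchIn x i)))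
  ka<Ba : k * a < B * a
  ka<Ba = *-monoˡ-< a {{>-nonZero 0<a}} (s≤s (n≤1+n k))
  regroup : ∀ b u v w → b * (u + w) + b * v ≡ b * (u + v) + b * w
  regroup = solve-∀
  regroup′ : ∀ b u w c → b * u + (b * w + c) ≡ b * (u + w) + c
  regroup′ = solve-∀

module Rank {n} (R : Fin n → Fin n → Set) (R? : Decidable R) (wf : WellFounded (flip R)) where

  rankAcc : ∀ x → Acc (flip R) x → ℕ
  rankBelow : ∀ {x} → WfRec (flip R) (Acc (flip R)) x → ∀ y → Dec (R x y) → ℕ
  rankAcc x (acc rs) = suc (sum λ y → rankBelow rs y (R? x y))
  rankBelow rs y (yes xRy) = rankAcc y (rs xRy)
  rankBelow rs y (no _)    = 0

  rankAcc-irrelevant : ∀ x (p q : Acc (flip R) x) → rankAcc x p ≡ rankAcc x q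
  rankBelow-irrelevant : ∀ {x} (rs rs′ : WfRec (flip R) (Acc (flip R)) x) y (d : Dec (R x y)) →
                         rankBelow rs y d ≡ rankBelow rs′ y d
  rankAcc-irrelevant x (acc rs) (acc rs′) =
    cong suc (sum-cong-≗ λ y → rankBelow-irrelevant rs rs′ y (R? x y))
  rankBelow-irrelevant rs rs′ y (yes xRy) = rankAcc-irrelevant y (rs xRy) (rs′ xRy)
  rankBelow-irrelevant rs rs′ y (no _)    = refl

  rank : Fin n → ℕ
  rank x = rankAcc x (wf x)

  rank-< : ∀ {x y} → R x y → rank y < rank x
  rank-< {x} {y} xRy with wf x
  ... | acc rs = s≤s (≤-trans (below (R? x y)) (≤-sum (λ z → rankBelow rs z (R? x z)) y))
    where
    below : (d : Dec (R x y)) → rank y ≤ rankBelow rs y d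
    below (yes xRy′) = ≤-reflexive (rankAcc-irrelevant y (wf y) (rs xRy′))
    below (no ¬xRy)  = contradiction xRy ¬xRy

  module _ (b : ℕ) {{_ : NonZero b}} where

    weight : Fin n → ℕ
    weight v = b ^ (sum rank ∸ rank v)

    weight-pos : ∀ v → 0 < weight v
    weight-pos v = m^n>0 b (sum rank ∸ rank v)

    weight-step : ∀ {u v} → R u v → b * weight u ≤ weight v
    weight-step {u} {v} uRv = ^-monoʳ-≤ b (∸-monoʳ-< (rank-< uRv) (≤-sum rank u))

_≟ᶜ_ : DecidableEquality Colour
blue ≟ᶜ blue = yes refl
blue ≟ᶜ red  = no λ ()
red  ≟ᶜ blue = no λ ()
red  ≟ᶜ red  = yes refl

covered-snoc : ∀ {n} {vs : List (Fin n)} {rest w} → (∀ v → v ∈ vs ⊎ v ∈ₛ rest) →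
               ∀ v → v ∈ vs ++ [ w ] ⊎ v ∈ₛ rest - w
covered-snoc {vs = vs} {w = w} covered v with covered v | v ≟ w
... | inj₁ v∈vs   | _        = inj₁ (∈-++⁺ˡ v∈vs)
... | inj₂ _      | yes refl = inj₁ (∈-++⁺ʳ vs (here refl))
... | inj₂ v∈rest | no v≢w   = inj₂ (x∈p∧x≢y⇒x∈p-y v∈rest v≢w)

module _ {n} (D : ColouredDigraph n) (c : Colour) where
  open import Data.List.Membership.DecPropositional {A = Fin n} _≟_ using (_∈?_)

  Walk : Fin n → List (Fin n) → Fin n → Set
  Walk a []       b = a ≡ b
  Walk a (v ∷ vs) b = ArcOf D c a v × Walk v vs b

  walk-close : ∀ {a vs b x₀} → Walk a vs b → ArcOf D c b x₀ → PathC D c x₀ a vs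
  walk-close {vs = []}    refl       b→x₀ = b→x₀
  walk-close {vs = v ∷ vs} (a→v , wk) b→x₀ = a→v , walk-close wk b→x₀

  walk-snoc : ∀ {a vs b w} → Walk a vs b → ArcOf D c b w → Walk a (vs ++ [ w ]) w
  walk-snoc {vs = []}     refl       b→w = b→w , refl
  walk-snoc {vs = v ∷ vs} (a→v , wk) b→w = a→v , walk-snoc wk b→w

  walk-back-cycle : ∀ {a vs b w} → Walk a vs b → Unique (a ∷ vs) → ArcOf D c b w → w ∈ a ∷ vs →
                    MonoCycle D c
  walk-back-cycle wk distinct b→w (here refl) = _ , _ , distinct , walk-close wk b→w
  walk-back-cycle {vs = v ∷ vs} (_ , wk) (_ ∷ distinct) b→w (there w∈vs) =
    walk-back-cycle wk distinct b→w w∈vs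

  module _ (acyclic : ¬ MonoCycle D c) where

    -- Every vertex is on the walk or in rest; an arc back onto the walk would close a
    -- monochromatic cycle, so each step of a c-walk shrinks rest.
    walk-end-accessible : ∀ {a vs b} (rest : Subset n) → Acc _⊂_ rest →
                          Walk a vs b → Unique (a ∷ vs) → (∀ u → u ∈ a ∷ vs ⊎ u ∈ₛ rest) →
                          Acc (flip (ArcOf D c)) b
    walk-end-accessible {a} {vs} rest (acc smaller) wk distinct covered = acc extend
      where
      extend : ∀ {w} → ArcOf D c _ w → Acc (flip (ArcOf D c)) w
      extend {w} b→w with w ∈? a ∷ vs
      ... | yes w∈walk = contradiction (walk-back-cycle wk distinct b→w w∈walk) acyclic
      ... | no w∉walk  = walk-end-accessible (rest - w) (smaller (x∈p⇒p-x⊂p w∈rest))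
                           (walk-snoc wk b→w) (++⁺ distinct ([] ∷ []) λ { (p , here refl) → w∉walk p })
                           (covered-snoc covered)
        where
        w∈rest : w ∈ₛ rest
        w∈rest = fromInj₂ (λ w∈walk → contradiction w∈walk w∉walk) (covered w)

    acyclic⇒wellFounded : WellFounded (flip (ArcOf D c))
    acyclic⇒wellFounded v = walk-end-accessible ⊤ (⊂-wellFounded ⊤) refl ([] ∷ [])
                              (λ u → inj₂ ∈⊤)

module _ {n} (D : ColouredDigraph n) where

  arc? : Decidable (Arc D)
  arc? u v with col D u v
  ... | just c  = yes (c , refl)
  ... | nothing = no λ ()

  arcOf? : ∀ c → Decidable (ArcOf D c)
  arcOf? c u v = ≡-dec _≟ᶜ_ (col D u v) (just c)

  no-loop : ∀ v → ¬ Arc D v v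
  no-loop v (c , v→v) with trans (sym (loopless D v)) v→v
  ... | ()

  arc-≢ : ∀ {u v} → Arc D u v → u ≢ v
  arc-≢ u→v refl = no-loop _ u→v

  Absorbed : (Fin n → Bool) → Fin n → Set
  Absorbed K v = ∃ λ k → K k ≡ true × Arc D v k

  absorbed? : ∀ K → (v : Fin n) → Dec (Absorbed K v)
  absorbed? K v = any? λ k → (K k ≟ᵇ true) ×-dec arc? v k

  Free : (Fin n → Bool) → Fin n → Set
  Free K v = K v ≡ false × ¬ Absorbed K v

  free? : ∀ K → (v : Fin n) → Dec (Free K v)
  free? K v = (K v ≟ᵇ false) ×-dec ¬? (absorbed? K v)

  Independent : (Fin n → Bool) → Set
  Independent K = ∀ u v → K u ≡ true → K v ≡ true → ¬ Arc D u v

  RedSink : (Fin n → Bool) → Fin n → Set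
  RedSink K x = ∀ y → ArcOf D red x y → ¬ Free K y

  RedSafe : (Fin n → Bool) → Set
  RedSafe K = ∀ k → K k ≡ true → RedSink K k

  arc-into-free-is-blue : ∀ {K x v} → RedSafe K → Free K x → K v ≡ true → Arc D v x → ArcOf D blue v x
  arc-into-free-is-blue safe xFree vK (red  , v→x) = contradiction xFree (safe _ vK _ v→x)
  arc-into-free-is-blue safe xFree vK (blue , v→x) = v→x

  insert : (Fin n → Bool) → Fin n → Fin n → Bool
  insert K x v with v ≟ x
  ... | yes _ = true
  ... | no _ with arc? v x
  ...   | yes _ = false
  ...   | no _  = K v

  insert-self : ∀ K x → insert K x x ≡ true
  insert-self K x with x ≟ x
  ... | yes _  = refl
  ... | no x≢x = contradiction refl x≢x

  insert-keep : ∀ K x v → v ≢ x → ¬ Arc D v x → insert K x v ≡ K v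
  insert-keep K x v v≢x ¬v→x with v ≟ x
  ... | yes v≡x = contradiction v≡x v≢x
  ... | no _ with arc? v x
  ...   | yes v→x = contradiction v→x ¬v→x
  ...   | no _    = refl

  insert-true⁻ : ∀ K x v → insert K x v ≡ true → v ≡ x ⊎ (¬ Arc D v x × K v ≡ true)
  insert-true⁻ K x v vK′ with v ≟ x
  ... | yes v≡x = inj₁ v≡x
  ... | no _ with arc? v x
  insert-true⁻ K x v () | no _ | yes _
  ... | no ¬v→x = inj₂ (¬v→x , vK′)

  insert-dropped : ∀ K x v → K v ≡ true → insert K x v ≡ false → Arc D v x
  insert-dropped K x v vK vK′ with v ≟ x
  insert-dropped K x v vK () | yes _
  ... | no _ with arc? v x
  ...   | yes v→x = v→x
  ...   | no _    = contradiction (trans (sym vK) vK′) λ ()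

  independent-insert : ∀ {K x} → Independent K → Free K x → Independent (insert K x)
  independent-insert {K} {x} indK xFree u v uK′ vK′ u→v
    with insert-true⁻ K x u uK′ | insert-true⁻ K x v vK′
  ... | inj₁ refl          | inj₁ refl          = no-loop u u→v
  ... | inj₁ refl          | inj₂ (_ , vK)      = proj₂ xFree (v , vK , u→v)
  ... | inj₂ (¬u→x , _)    | inj₁ refl          = ¬u→x u→v
  ... | inj₂ (_ , uK)      | inj₂ (_ , vK)      = indK u v uK vK u→v

  member-≢ : ∀ {K : Fin n → Bool} {a b} → K a ≡ true → K b ≡ false → a ≢ b
  member-≢ aK bK refl = contradiction (trans (sym aK) bK) λ ()

  pattern first  = inj₁ refl
  pattern second = inj₂ (inj₁ refl)
  pattern third  = inj₂ (inj₂ (inj₁ refl))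
  pattern fourth = inj₂ (inj₂ (inj₂ refl))

  ExtraArc : Fin n → Fin n → Fin n → Fin n → Set
  ExtraArc v₁ v₂ v₃ v₄ = ∃ λ p → ∃ λ q →
    In4 D v₁ v₂ v₃ v₄ p × In4 D v₁ v₂ v₃ v₄ q × Arc D p q
    × ¬ ((p ≡ v₁ × q ≡ v₂) ⊎ (p ≡ v₂ × q ≡ v₃) ⊎ (p ≡ v₃ × q ≡ v₄))
    × q ≢ v₂

  -- k and x lie in insert K x, u and k₀ do not; every arc other than the path arcs and
  -- those into u is a loop, joins two vertices of K, or has a free tail (u for insert K x,
  -- x for K) and its head in the set.
  no-extra-arc : ∀ {K x k u k₀} → Independent K → Free K x → k ≡ x ⊎ (¬ Arc D k x × K k ≡ true) →
                 insert K x k ≡ true → Free (insert K x) u → K k₀ ≡ true → ¬ ExtraArc k u k₀ x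
  no-extra-arc _ _ _ _ _ _ (_ , _ , _ , second , _ , _ , q≢u) = q≢u refl
  no-extra-arc _ _ _ _ _ _ (_ , _ , first , first , p→q , _ , _) = no-loop _ p→q
  no-extra-arc _ xFree (inj₁ refl) _ _ k₀K (_ , _ , first , third , p→q , _ , _) =
    proj₂ xFree (_ , k₀K , p→q)
  no-extra-arc indK _ (inj₂ (_ , kK)) _ _ k₀K (_ , _ , first , third , p→q , _ , _) =
    indK _ _ kK k₀K p→q
  no-extra-arc _ _ (inj₁ refl) _ _ _ (_ , _ , first , fourth , p→q , _ , _) = no-loop _ p→q
  no-extra-arc _ _ (inj₂ (¬k→x , _)) _ _ _ (_ , _ , first , fourth , p→q , _ , _) = ¬k→x p→q
  no-extra-arc _ _ _ kK′ (_ , ¬absorbed′) _ (_ , _ , second , first , p→q , _ , _) =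
    ¬absorbed′ (_ , kK′ , p→q)
  no-extra-arc _ _ _ _ _ _ (_ , _ , second , third , _ , not-path , _) =
    not-path (inj₂ (inj₁ (refl , refl)))
  no-extra-arc {K} {x} _ _ _ _ (_ , ¬absorbed′) _ (_ , _ , second , fourth , p→q , _ , _) =
    ¬absorbed′ (x , insert-self K x , p→q)
  no-extra-arc _ _ (inj₁ refl) _ _ _ (_ , _ , third , first , _ , not-path , _) =
    not-path (inj₂ (inj₂ (refl , refl)))
  no-extra-arc indK _ (inj₂ (_ , kK)) _ _ k₀K (_ , _ , third , first , p→q , _ , _) =
    indK _ _ k₀K kK p→q
  no-extra-arc _ _ _ _ _ _ (_ , _ , third , third , p→q , _ , _) = no-loop _ p→q
  no-extra-arc _ _ _ _ _ _ (_ , _ , third , fourth , _ , not-path , _) =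
    not-path (inj₂ (inj₂ (refl , refl)))
  no-extra-arc _ _ (inj₁ refl) _ _ _ (_ , _ , fourth , first , p→q , _ , _) = no-loop _ p→q
  no-extra-arc _ xFree (inj₂ (_ , kK)) _ _ _ (_ , _ , fourth , first , p→q , _ , _) =
    proj₂ xFree (_ , kK , p→q)
  no-extra-arc _ xFree _ _ _ k₀K (_ , _ , fourth , third , p→q , _ , _) =
    proj₂ xFree (_ , k₀K , p→q)
  no-extra-arc _ _ _ _ _ _ (_ , _ , fourth , fourth , p→q , _ , _) = no-loop _ p→q

  insert-free⁻ : ∀ {K x u} → Free (insert K x) u → K u ≡ false
  insert-free⁻ {K} {x} {u} (uK′ , ¬absorbed′) =
    trans (sym (insert-keep K x u (member-≢ (insert-self K x) uK′ ∘ sym) ¬u→x)) uK′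
    where
    ¬u→x : ¬ Arc D u x
    ¬u→x u→x = ¬absorbed′ (x , insert-self K x , u→x)

  dropped-absorber : ∀ {K x u} → RedSafe K → Free K x → Free (insert K x) u → ¬ Free K u →
                     ∃ λ k₀ → K k₀ ≡ true × insert K x k₀ ≡ false × Arc D u k₀ × ArcOf D blue k₀ x
  dropped-absorber {K} {x} {u} safeK xFree uFree′@(_ , ¬absorbed′) ¬uFree
    with decidable-stable (absorbed? K u) (λ ¬absorbed → ¬uFree (insert-free⁻ uFree′ , ¬absorbed))
  ... | k₀ , k₀K , u→k₀ with insert K x k₀ in k₀K′
  ...   | true  = contradiction (k₀ , k₀K′ , u→k₀) ¬absorbed′
  ...   | false = k₀ , k₀K , k₀K′ , u→k₀ ,
                  arc-into-free-is-blue safeK xFree k₀K (insert-dropped K x k₀ k₀K k₀K′)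

  redSafe-insert : Condition-ii D → ∀ {K x} → Independent K → RedSafe K → Free K x → RedSink K x →
                   RedSafe (insert K x)
  redSafe-insert cond {K} {x} indK safeK xFree xSink k kK′ u k→u uFree′@(uK′ , _)
    with insert-true⁻ K x k kK′
  ... | k≡x@(inj₁ refl) with dropped-absorber safeK xFree uFree′ (xSink u k→u)
  ...   | k₀ , k₀K , k₀K′ , u→k₀ , k₀→x =
          no-extra-arc indK xFree k≡x kK′ uFree′ k₀K (cond x u k₀ x k→u u→k₀ k₀→x closed)
    where
    closed : Open4 D x u k₀ x ⊎ Closed4 D x u k₀ x
    closed = inj₂ (refl , member-≢ kK′ uK′ , member-≢ kK′ k₀K′ , arc-≢ u→k₀)
  redSafe-insert cond {K} {x} indK safeK xFree xSink k kK′ u k→u uFree′@(uK′ , _)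
      | k≢x@(inj₂ (_ , kK)) with dropped-absorber safeK xFree uFree′ (safeK k kK u k→u)
  ...   | k₀ , k₀K , k₀K′ , u→k₀ , k₀→x =
          no-extra-arc indK xFree k≢x kK′ uFree′ k₀K (cond k u k₀ x k→u u→k₀ k₀→x open′)
    where
    open′ : Open4 D k u k₀ x ⊎ Closed4 D k u k₀ x
    open′ = inj₁ (member-≢ kK′ uK′ , member-≢ kK′ k₀K′ , member-≢ kK (proj₁ xFree) ,
                  arc-≢ u→k₀ , member-≢ (insert-self K x) uK′ ∘ sym , member-≢ k₀K (proj₁ xFree))

  find-red-sink : ∀ K {u} → Acc (flip (ArcOf D red)) u → Free K u → ∃ λ x → Free K x × RedSink K x
  find-red-sink K {u} (acc rs) uFree with any? (λ y → arcOf? red u y ×-dec free? K y)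
  ... | yes (y , u→y , yFree) = find-red-sink K (rs u→y) yFree
  ... | no ¬step              = u , uFree , λ y u→y yFree → ¬step (y , u→y , yFree)

  saturated⇒kernel : ∀ K → Independent K → (∀ v → ¬ Free K v) → HasKernel D
  saturated⇒kernel K indK saturated = S , independent , absorbing
    where
    S : Subset n
    S = tabulate K
    ∈S⁻ : ∀ {v} → v ∈ₛ S → K v ≡ true
    ∈S⁻ {v} v∈S = trans (sym (lookup∘tabulate K v)) ([]=⇒lookup v∈S)
    ∈S⁺ : ∀ {v} → K v ≡ true → v ∈ₛ S
    ∈S⁺ {v} vK = lookup⇒[]= v S (trans (lookup∘tabulate K v) vK)
    independent : ∀ u v → u ∈ₛ S → v ∈ₛ S → ¬ Arc D u v
    independent u v u∈S v∈S = indK u v (∈S⁻ u∈S) (∈S⁻ v∈S)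
    absorbing : ∀ v → v ∉ₛ S → ∃ λ u → u ∈ₛ S × Arc D v u
    absorbing v v∉S with K v in vK
    ... | true  = contradiction (∈S⁺ vK) v∉S
    ... | false with decidable-stable (absorbed? K v) (λ ¬absorbed → saturated v (vK , ¬absorbed))
    ...   | u , uK , v→u = u , ∈S⁺ uK , v→u

  module Termination (blue-wf : WellFounded (flip (ArcOf D blue))) where
    open Rank (ArcOf D blue) (arcOf? blue) blue-wf using (weight; weight-pos; weight-step)

    missing : (Fin n → Bool) → Fin n → ℕ
    missing K v = if K v then 0 else weight (suc n) v

    deficit : (Fin n → Bool) → ℕ
    deficit K = sum (missing K)

    deficit-insert : ∀ {K x} → RedSafe K → Free K x → deficit (insert K x) < deficit K
    deficit-insert {K} {x} safeK xFree =
      sum-<-exchange (missing K) (missing (insert K x)) x (weight-pos (suc n) x) gain loss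
      where
      gain : missing (insert K x) x + weight (suc n) x ≤ missing K x
      gain rewrite insert-self K x | proj₁ xFree = ≤-refl
      loss : ∀ v → suc n * missing (insert K x) v ≤ suc n * missing K v + weight (suc n) x
      -- Splitting on the same tests as insert lets insert K x v compute.
      loss v with v ≟ x
      ... | yes refl rewrite *-zeroʳ (suc n) = z≤n
      ... | no _ with arc? v x
      ...   | no _    = m≤m+n _ _
      ...   | yes v→x with K v in vK
      ...     | false = m≤m+n _ _
      ...     | true rewrite *-zeroʳ (suc n) =
                  weight-step (suc n) (arc-into-free-is-blue safeK xFree vK v→x)

    kernel-by-insertion : Condition-ii D → WellFounded (flip (ArcOf D red)) →
                          ∀ K → Acc _<_ (deficit K) → Independent K → RedSafe K → HasKernel D
    kernel-by-insertion cond red-wf K (acc smaller) indK safeK with any? (free? K)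
    ... | no ¬free = saturated⇒kernel K indK λ v vFree → ¬free (v , vFree)
    ... | yes (u , uFree) with find-red-sink K (red-wf u) uFree
    ...   | x , xFree , xSink =
            kernel-by-insertion cond red-wf (insert K x) (smaller (deficit-insert safeK xFree))
              (independent-insert indK xFree) (redSafe-insert cond indK safeK xFree xSink)

proposition2p5 : (n : ℕ) (D : ColouredDigraph n) →
    ¬ HasMonoCycle D → Condition-ii D → HasKernel D
proposition2p5 n D no-mono-cycle cond =
  Termination.kernel-by-insertion D (wf blue) cond (wf red)
    (λ _ → false) (<-wellFounded _) (λ _ _ ()) (λ _ ())
  where
  wf : ∀ c → WellFounded (flip (ArcOf D c))
  wf c = acyclic⇒wellFounded D c (λ cycle → no-mono-cycle (c , cycle))
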